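{- Let $M$ be a matroid on a finite ground set $E$ with rank function $r$, and $k>0$ an integer. Let $\mathcal F_k=\{\sigma\subseteq\vec U:\sigma\text{ is a star with }\|\sigma\|<k\}$, where for a star $\sigma=\{(A_i,B_i):i=0,\dots,n\}$ we put $\|\sigma\|=\sum_{i=0}^nr(B_i)-n\,r(M)$. Then $\vec S_k$ is $\mathcal F_k$-separable.
   Context: $\lambda(X)=r(X)+r(E\setminus X)-r(M)$. $\vec U$ is the set of all bipartitions $(X,Y)$ of $E$ (parts possibly empty), a universe with $(A,B)\le(C,D)$ iff $A\subseteq C,B\supseteq D$, inverse $(B,A)$, supremum $(A\cup C,B\cap D)$, infimum $(A\cap C,B\cup D)$. $\vec S_k=\{(X,Y)\in\vec U:\lambda(X)<k\}$, $S_k$ its set of unoriented separations $\{X,Y\}$. For oriented $\vec s$, $\overleftarrow s$ is its inverse; $s$ is degenerate if $\vec s=\overleftarrow s$; $\vec r$ is trivial in $\vec S_k$ if some $s\in S_k$ has $\vec r<\vec s$, $\vec r<\overleftarrow s$. A star is a nonempty set $\sigma$ with $\vec r\le\overleftarrow s$ for all distinct $\vec r,\vec s\in\sigma$. $\mathcal F$ forces $\vec r$ if $\{\overleftarrow r\}\in\mathcal F$ or $r$ is degenerate. For nontrivial nondegenerate $\vec r$ and $\vec s_0\in\vec S_k$ with $\vec r\le\vec s_0$: $\vec S_{\ge\vec r}$ is the set of orientations of those $s\in S_k$ with an orientation $\vec s\ge\vec r$; the shifting map $f^{\vec r}_{\vec s_0}$ sends $\vec s\mapsto\vec s\vee\vec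 s_0$ and $\overleftarrow s\mapsto(\vec s\vee\vec s_0)^*$ for each $\vec s\ge\vec r$ in $\vec S_{\ge\vec r}\setminus\{\overleftarrow r\}$. $\vec s_0$ is linked to $\vec r$ if $\vec s_0\ge\vec r$ and $\vec s\vee\vec s_0\in\vec S_k$ for all $\vec s\in\vec S_k$ with $\vec s\ge\vec r$, $\vec s\ne\overleftarrow r$; it is $\mathcal F$-linked to $\vec r$ if moreover $f^{\vec r}_{\vec s_0}(\sigma)\in\mathcal F$ for every star $\sigma\in\mathcal F$ with $\sigma\subseteq\vec S_{\ge\vec r}\setminus\{\overleftarrow r\}$ having an element $\ge\vec r$. $\vec S_k$ is $\mathcal F$-separable if for all $\vec r,\vec r'\in\vec S_k$ with $\vec r\le\vec r'$ such that neither $\vec r$ nor $\overleftarrow{r'}$ is forced by $\mathcal F$, there is $s_0\in S_k$ with an orientation $\vec s_0$ $\mathcal F$-linked to $\vec r$ such that $\overleftarrow{s_0}$ is $\mathcal F$-linked to $\overleftarrow{r'}$. -}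

module Defs where

open import Data.Nat as ℕ using (ℕ; zero; suc)
open import Data.Integer as ℤ using (ℤ; +_; _-_)
open import Data.Bool using (Bool) renaming (_≟_ to _≟ᵇ_)
open import Data.Fin.Subset using (Subset; ∁; _∪_; _∩_; _⊆_; ⊤; ∣_∣)
open import Data.Fin.Subset.Properties using (_⊆?_)
open import Data.Vec.Properties using (≡-dec)
open import Data.List using (List; []; _∷_; [_]; map; length; deduplicate)
open import Data.List.Relation.Unary.All using (All)
open import Data.List.Relation.Unary.Any using (Any)
open import Data.List.Relation.Unary.Unique.Propositional using (Unique)
open import Data.List.Membership.Propositional using (_∈_)
open import Data.Product using (_×_; Σ-syntax)
open import Data.Sum using (_⊎_)
open import Relation.Nullary using (¬_; Dec; yes; no)
open import Relation.Nullary.Decidable using (_×-dec_)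
open import Relation.Binary.PropositionalEquality using (_≡_; _≢_)

record Matroid (n : ℕ) : Set where
  field
    r        : Subset n → ℕ
    r-bound  : ∀ X → r X ℕ.≤ ∣ X ∣
    r-mono   : ∀ X Y → X ⊆ Y → r X ℕ.≤ r Y
    r-submod : ∀ X Y → r (X ∪ Y) ℕ.+ r (X ∩ Y) ℕ.≤ r X ℕ.+ r Y

module _ {n : ℕ} (M : Matroid n) where
  open Matroid M

  rM : ℕ
  rM = r ⊤

  conn : Subset n → ℤ
  conn X = (+ r X ℤ.+ + r (∁ X)) - + rM

-- Oriented bipartitions (X , E∖X) of E are represented by their first part X.
Sep : ℕ → Set
Sep n = Subset n

module _ {n : ℕ} where
  fst snd : Sep n → Subset n
  fst X = X
  snd X = ∁ X

  inv : Sep n → Sep n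
  inv X = ∁ X

  _≤ˢ_ : Sep n → Sep n → Set
  s ≤ˢ t = (fst s ⊆ fst t) × (snd t ⊆ snd s)

  _≤ˢ?_ : (s t : Sep n) → Dec (s ≤ˢ t)
  s ≤ˢ? t = (fst s ⊆? fst t) ×-dec (snd t ⊆? snd s)

  _<ˢ_ : Sep n → Sep n → Set
  s <ˢ t = s ≤ˢ t × s ≢ t

  _≟ˢ_ : (s t : Sep n) → Dec (s ≡ t)
  _≟ˢ_ = ≡-dec _≟ᵇ_

  -- supremum (A∪C , B∩D); with B = E∖A, D = E∖C this is represented by A ∪ C
  _∨ˢ_ : Sep n → Sep n → Sep n
  s ∨ˢ t = fst s ∪ fst t

  degenerate : Sep n → Set
  degenerate s = s ≡ inv s

  IsStar : List (Sep n) → Set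
  IsStar σ = (σ ≢ []) × Unique σ × (∀ {x y} → x ∈ σ → y ∈ σ → x ≢ y → x ≤ˢ inv y)

  image : (Sep n → Sep n) → List (Sep n) → List (Sep n)
  image f σ = deduplicate _≟ˢ_ (map f σ)

module _ {n : ℕ} (M : Matroid n) (k : ℕ) where
  open Matroid M

  InS : Sep n → Set
  InS s = conn M s ℤ.< + k

  trivial : Sep n → Set
  trivial t = Σ[ s ∈ Sep n ] (InS s × t <ˢ s × t <ˢ inv s)

  -- ‖σ‖ = Σ_{i=0}^{m} r(B_i) − m·r(M), where σ has m+1 elements
  sumRB : List (Sep n) → ℤ
  sumRB []      = + 0
  sumRB (s ∷ σ) = + r (snd s) ℤ.+ sumRB σ

  norm : List (Sep n) → ℤ
  norm σ = sumRB σ - (+ (length σ ℕ.∸ 1)) ℤ.* (+ rM M)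

  Fk : List (Sep n) → Set
  Fk σ = IsStar σ × norm σ ℤ.< + k

  module _ (F : List (Sep n) → Set) where
    forces : Sep n → Set
    forces t = F [ inv t ] ⊎ degenerate t

    InS≥ : Sep n → Sep n → Set
    InS≥ t s = InS s × (t ≤ˢ s ⊎ t ≤ˢ inv s)

    shift : Sep n → Sep n → Sep n → Sep n
    shift t s0 s with t ≤ˢ? s
    ... | yes _ = s ∨ˢ s0
    ... | no  _ = inv (inv s ∨ˢ s0)

    linked : Sep n → Sep n → Set
    linked t s0 = t ≤ˢ s0 ×
      (∀ s → InS s → t ≤ˢ s → s ≢ inv t → InS (s ∨ˢ s0))

    Flinked : Sep n → Sep n → Set
    Flinked t s0 = linked t s0 ×
      (∀ σ → IsStar σ → F σ →
         All (λ s → InS≥ t s × s ≢ inv t) σ →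
         Any (λ s → t ≤ˢ s) σ →
         F (image (shift t s0) σ))

    separable : Set
    separable = ∀ t t' → InS t → InS t' → t ≤ˢ t' →
      ¬ forces t → ¬ forces (inv t') →
      Σ[ s0 ∈ Sep n ] (InS s0 × Flinked t s0 × Flinked (inv t') (inv s0))

module Submission where

-- Put L(X) = r(X) + r(E∖X) = λ(X) + r(M), a submodular function invariant
-- under complement.  Given t ≤ t' with t and inv t' unforced, take S₀ of
-- minimal L with t ⊆ S₀ ⊆ t'; then S₀ is L-minimal between t and S₀, and
-- E∖S₀ between E∖t' and E∖S₀.  Unforced means r(t), r(E∖t') ≥ k > 0, so t
-- and E∖t' are nonempty.  It remains to show (Flinked-minimal): if X ≠ ∅ and
-- S₀ ⊇ X is L-minimal between X and S₀, then S₀ is 𝓕_k-linked to X.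
-- Linkedness is the uncrossing L(s ∪ S₀) ≤ L(s) for s ⊇ X.  A star σ with an
-- element a ⊇ X is shifted to a star; telescoping submodularity over σ∖a,
-- together with minimality of S₀, shows Σ r(E∖s) does not grow, and since
-- ‖σ‖ = r(M) − Σ (r(M) − r(E∖s)) its order does not grow either (duplicates
-- in the image are empty and contribute nothing).

open import Defs
open import Data.Nat as ℕ using (ℕ; zero; suc; _+_; _*_; _∸_; _≤_; _<_)
open import Data.Nat.Properties as ℕP
  using (≤-refl; ≤-trans; ≤-reflexive; <-≤-trans; +-comm; +-mono-≤; +-monoˡ-≤; +-monoʳ-≤;
         +-cancelʳ-≤; m∸n+n≡m; n∸n≡0; ≮⇒≥; <⇒≱; +-commutativeSemigroup)
open import Data.Nat.ListAction using (sum)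
open import Data.Nat.ListAction.Properties using (sum-↭)
open import Data.Nat.Tactic.RingSolver as ℕSolver using ()
open import Data.Integer as ℤ using (ℤ; +_; _-_)
import Data.Integer.Properties as ℤP
open import Data.Integer.Tactic.RingSolver as ℤSolver using ()
open import Algebra.Properties.CommutativeSemigroup +-commutativeSemigroup using (interchange)
open import Data.Fin using (Fin)
open import Data.Fin.Subset using (Subset; ∁; _∪_; _∩_; _⊆_; ⊤; ∣_∣; _∈_; _∉_; Nonempty)
open import Data.Fin.Subset.Properties
  using (x∈p∪q⁻; x∈p∪q⁺; x∈p∩q⁻; x∈p∩q⁺; x∉p⇒x∈∁p; x∈∁p⇒x∉p; x∉∁p⇒x∈p; p⊆q⇒∁p⊇∁q;
         p∩q⊆q; ⊆-refl; ⊆-trans; _⊆?_; ⊆-antisym; ⊆⊤; _∈?_; anySubset?; nonempty?; Empty-unique;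
         ∣⊥∣≡0; ∪-∩-booleanAlgebra)
open import Data.List using (List; []; _∷_; [_]; map; length; filter; deduplicate; _++_)
open import Data.List.Properties using (map-cong-local; length-map)
open import Data.List.Relation.Unary.All as All using (All; []; _∷_)
open import Data.List.Relation.Unary.All.Properties as AllP using ()
open import Data.List.Relation.Unary.Any using (Any; here; there)
open import Data.List.Relation.Unary.Any.Properties as AnyP using ()
open import Data.List.Relation.Unary.AllPairs as AllPairs using (AllPairs; []; _∷_)
open import Data.List.Relation.Unary.AllPairs.Properties as AllPairsP using ()
open import Data.List.Relation.Unary.Unique.Propositional using (Unique)
open import Data.List.Relation.Unary.Unique.DecPropositional.Properties using (deduplicate-!)
open import Data.List.Membership.Propositional using (find) renaming (_∈_ to _∈ˡ_)
open import Data.List.Membership.Propositional.Properties using (∈-map⁻; ∈-∃++)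
open import Data.List.Relation.Binary.Permutation.Propositional using (_↭_; ↭⇒↭ₛ)
open import Data.List.Relation.Binary.Permutation.Propositional.Properties
  using (map⁺) renaming (shift to ↭-shift)
import Data.List.Relation.Binary.Permutation.Setoid.Properties as SetoidPermutation
open import Data.Product using (_×_; _,_; proj₁; proj₂; Σ-syntax; ∃)
open import Data.Sum using (_⊎_; inj₁; inj₂)
open import Function using (_∘_)
open import Relation.Nullary using (¬_; yes; no; contradiction; ¬?)
open import Relation.Nullary.Decidable using (_×-dec_)
open import Relation.Unary using (Decidable)
open import Relation.Binary.Definitions using (Symmetric; DecidableEquality)
open import Relation.Binary.PropositionalEquality
  using (_≡_; _≢_; refl; sym; trans; cong; cong₂; subst; subst₂; setoid; module ≡-Reasoning)

+-≤-chain : ∀ {a b c d x y z} → a + x ≤ b + y → c + y ≤ d + z → (a + c) + x ≤ (b + d) + z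
+-≤-chain {a} {b} {c} {d} {x} {y} {z} h₁ h₂ = +-cancelʳ-≤ y _ _ (begin
    a + c + x + y       ≡⟨ pair-up a c x y ⟩
    (a + x) + (c + y)   ≤⟨ +-mono-≤ h₁ h₂ ⟩
    (b + y) + (d + z)   ≡⟨ sym (pair-up′ b d z y) ⟩
    b + d + z + y       ∎)
  where
  open ℕP.≤-Reasoning
  pair-up : ∀ p q u v → p + q + u + v ≡ (p + u) + (q + v)
  pair-up = ℕSolver.solve-∀
  pair-up′ : ∀ p q u v → p + q + u + v ≡ (p + v) + (q + u)
  pair-up′ = ℕSolver.solve-∀

+-≤-cancel : ∀ {a b c d x y} → a + x ≤ b + y → c + y ≤ d + x → a + c ≤ b + d
+-≤-cancel {a} {b} {c} {d} {x} {y} h₁ h₂ =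
  +-cancelʳ-≤ x (a + c) (b + d) (+-≤-chain {a} {b} {c} {d} {x} {y} {x} h₁ h₂)

sum-swap : ∀ {x y z w : ℤ} → x ℤ.+ y ≡ z ℤ.+ w → y - w ≡ z - x
sum-swap {x} {y} {z} {w} eq = begin
    y - w                 ≡⟨ add-sub-left x y w ⟩
    (x ℤ.+ y) - x - w     ≡⟨ cong (λ e → e - x - w) eq ⟩
    (z ℤ.+ w) - x - w     ≡⟨ sym (add-sub-right z w x) ⟩
    z - x                 ∎
  where
  open ≡-Reasoning
  add-sub-left : ∀ p q u → q - u ≡ (p ℤ.+ q) - p - u
  add-sub-left = ℤSolver.solve-∀
  add-sub-right : ∀ p q u → p - u ≡ (p ℤ.+ q) - u - q
  add-sub-right = ℤSolver.solve-∀

module _ {A : Set} where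
  private module Perm = SetoidPermutation (setoid A)

  extract : ∀ {a : A} {σ} → a ∈ˡ σ → ∃ λ rest → σ ↭ a ∷ rest
  extract a∈σ with xs , ys , refl ← ∈-∃++ a∈σ = xs ++ ys , ↭-shift _ xs ys

  AllPairs-↭ : ∀ {R : A → A → Set} → Symmetric R → ∀ {xs ys} → xs ↭ ys → AllPairs R xs → AllPairs R ys
  AllPairs-↭ R-sym p = Perm.AllPairs-resp-↭ R-sym ((λ { refl r → r }) , (λ { refl r → r })) (↭⇒↭ₛ p)

  AllPairs-distinct : ∀ {R : A → A → Set} {xs} → Unique xs →
                      (∀ {x y} → x ∈ˡ xs → y ∈ˡ xs → x ≢ y → R x y) → AllPairs R xs
  AllPairs-distinct []             _         = []
  AllPairs-distinct (x∉xs ∷ uniq) R-distinct =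
    All.tabulate (λ y∈xs → R-distinct (here refl) (there y∈xs) (All.lookup x∉xs y∈xs))
    ∷ AllPairs-distinct uniq (λ x∈ y∈ → R-distinct (there x∈) (there y∈))

  module _ (w : A → ℕ) where

    sum-filter : ∀ {P : A → Set} (P? : Decidable P) xs → All (λ x → P x ⊎ w x ≡ 0) xs →
                 sum (map w (filter P? xs)) ≡ sum (map w xs)
    sum-filter P? []       []              = refl
    sum-filter P? (x ∷ xs) (kept-or-0 ∷ h) with P? x | kept-or-0
    ... | yes _   | _         = cong (_+_ (w x)) (sum-filter P? xs h)
    ... | no ¬Px  | inj₁ Px   = contradiction Px ¬Px
    ... | no _    | inj₂ wx≡0 = trans (sum-filter P? xs h) (cong (_+ sum (map w xs)) (sym wx≡0))

    sum-deduplicate : (_≟_ : DecidableEquality A) → ∀ xs → AllPairs (λ x y → x ≡ y → w x ≡ 0) xs →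
                      sum (map w (deduplicate _≟_ xs)) ≡ sum (map w xs)
    sum-deduplicate _≟_ []       []             = refl
    sum-deduplicate _≟_ (x ∷ xs) (x-reps ∷ reps) =
      cong (_+_ (w x)) (trans (sum-filter (¬? ∘ (x ≟_)) _ (AllP.deduplicate⁺ _≟_ (All.map classify x-reps)))
                           (sum-deduplicate _≟_ xs reps))
      where
      classify : ∀ {y} → (x ≡ y → w x ≡ 0) → ¬ x ≡ y ⊎ w y ≡ 0
      classify {y} rep with x ≟ y
      ... | yes refl = inj₂ (rep refl)
      ... | no x≢y   = inj₁ x≢y

    sum-complement : ∀ T → (∀ x → w x ≤ T) → ∀ xs →
                     sum (map (λ x → T ∸ w x) xs) + sum (map w xs) ≡ length xs * T
    sum-complement T bounded []       = refl
    sum-complement T bounded (x ∷ xs) = begin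
        (T ∸ w x + sum (map (λ y → T ∸ w y) xs)) + (w x + sum (map w xs))
          ≡⟨ interchange (T ∸ w x) _ (w x) _ ⟩
        (T ∸ w x + w x) + (sum (map (λ y → T ∸ w y) xs) + sum (map w xs))
          ≡⟨ cong₂ _+_ (m∸n+n≡m (bounded x)) (sum-complement T bounded xs) ⟩
        T + length xs * T ∎
      where open ≡-Reasoning

minimiser : ∀ {m} (g : Subset m → ℕ) {P : Subset m → Set} → Decidable P → ∀ {S} → P S →
            Σ[ S₀ ∈ Subset m ] (P S₀ × (∀ S → P S → g S₀ ≤ g S))
minimiser {m} g {P} P? = descend _ ≤-refl
  where
  -- b bounds g S; each step strictly decreases g, so b steps suffice.
  descend : ∀ {S} b → g S ≤ b → P S → Σ[ S₀ ∈ Subset m ] (P S₀ × (∀ S → P S → g S₀ ≤ g S))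
  descend {S} b gS≤b PS with anySubset? (λ S' → P? S' ×-dec (g S' ℕ.<? g S))
  ... | no none-lower = S , PS , λ S' PS' → ≮⇒≥ (λ lower → none-lower (S' , PS' , lower))
  descend zero    gS≤0 _ | yes (_ , _ , lower)  = contradiction (<-≤-trans lower gS≤0) ℕP.n≮0
  descend (suc b) gS≤b _ | yes (_ , PS' , lower) = descend b (ℕP.≤-pred (<-≤-trans lower gS≤b)) PS'

module _ {n : ℕ} where
  open import Algebra.Lattice.Properties.BooleanAlgebra (∪-∩-booleanAlgebra n)
    using (¬-involutive; deMorgan₁; deMorgan₂)

  ∁-involutive : ∀ (p : Subset n) → ∁ (∁ p) ≡ p
  ∁-involutive = ¬-involutive

  ∁-∪ : ∀ (p q : Subset n) → ∁ (p ∪ q) ≡ ∁ p ∩ ∁ q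
  ∁-∪ = deMorgan₂

  ∁-∩ : ∀ (p q : Subset n) → ∁ (p ∩ q) ≡ ∁ p ∪ ∁ q
  ∁-∩ = deMorgan₁

  -- Stars are families of bipartitions with pairwise disjoint first parts.
  Disjoint : Subset n → Subset n → Set
  Disjoint x y = ∀ {j} → j ∈ x → j ∉ y

  Disjoint-sym : Symmetric Disjoint
  Disjoint-sym x#y j∈y j∈x = x#y j∈x j∈y

  ⊆⇒≤ˢ : ∀ {x y : Sep n} → x ⊆ y → x ≤ˢ y
  ⊆⇒≤ˢ x⊆y = x⊆y , p⊆q⇒∁p⊇∁q x⊆y

  ≤inv⇒Disjoint : ∀ {x y : Sep n} → x ≤ˢ inv y → Disjoint x y
  ≤inv⇒Disjoint (x⊆∁y , _) j∈x = x∈∁p⇒x∉p (x⊆∁y j∈x)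

  Disjoint⇒≤inv : ∀ {x y : Sep n} → Disjoint x y → x ≤ˢ inv y
  Disjoint⇒≤inv x#y = ⊆⇒≤ˢ (λ j∈x → x∉p⇒x∈∁p (x#y j∈x))

  ⊆∁-flip : ∀ {P Q : Subset n} → P ⊆ ∁ Q → Q ⊆ ∁ P
  ⊆∁-flip P⊆∁Q j∈Q = x∉p⇒x∈∁p (λ j∈P → x∈∁p⇒x∉p (P⊆∁Q j∈P) j∈Q)

  ∁⊆-flip : ∀ {P Q : Subset n} → ∁ P ⊆ Q → ∁ Q ⊆ P
  ∁⊆-flip ∁P⊆Q j∈∁Q = x∉∁p⇒x∈p (λ j∈∁P → x∈∁p⇒x∉p j∈∁Q (∁P⊆Q j∈∁P))

  -- s ∖ C, written as the shifting map produces it.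
  _∖_ : Subset n → Subset n → Subset n
  s ∖ C = ∁ (∁ s ∪ C)

  ∈∖⁻ : ∀ {j s C} → j ∈ s ∖ C → j ∈ s × j ∉ C
  ∈∖⁻ j∈s∖C = x∉∁p⇒x∈p (λ j∈∁s → x∈∁p⇒x∉p j∈s∖C (x∈p∪q⁺ (inj₁ j∈∁s)))
            , (λ j∈C → x∈∁p⇒x∉p j∈s∖C (x∈p∪q⁺ (inj₂ j∈C)))

  ∖-disjoint : ∀ {u v C} → Disjoint u v → Disjoint (u ∖ C) (v ∖ C)
  ∖-disjoint u#v j∈u∖C j∈v∖C = u#v (proj₁ (∈∖⁻ j∈u∖C)) (proj₁ (∈∖⁻ j∈v∖C))

  ∪-∖-disjoint : ∀ {u v C} → Disjoint u v → Disjoint (u ∪ C) (v ∖ C)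
  ∪-∖-disjoint {u} {v} {C} u#v j∈u∪C j∈v∖C with x∈p∪q⁻ u C j∈u∪C
  ... | inj₁ j∈u = u#v j∈u (proj₁ (∈∖⁻ j∈v∖C))
  ... | inj₂ j∈C = proj₂ (∈∖⁻ j∈v∖C) j∈C

  _∖⋃_ : Subset n → List (Subset n) → Subset n
  C ∖⋃ []      = C
  C ∖⋃ (s ∷ l) = ∁ s ∩ (C ∖⋃ l)

  ∖⋃-⊆ : ∀ C l → C ∖⋃ l ⊆ C
  ∖⋃-⊆ C []      j∈ = j∈
  ∖⋃-⊆ C (s ∷ l) j∈ = ∖⋃-⊆ C l (proj₂ (x∈p∩q⁻ (∁ s) _ j∈))

  ∈∖⋃⁺ : ∀ {j C} l → j ∈ C → All (j ∉_) l → j ∈ C ∖⋃ l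
  ∈∖⋃⁺ []      j∈C []            = j∈C
  ∈∖⋃⁺ (s ∷ l) j∈C (j∉s ∷ j∉l) = x∈p∩q⁺ (x∉p⇒x∈∁p j∉s , ∈∖⋃⁺ l j∈C j∉l)

  star-disjoint : ∀ {σ} → IsStar σ → ∀ {x y} → x ∈ˡ σ → y ∈ˡ σ → x ≢ y → Disjoint x y
  star-disjoint (_ , _ , pairwise) x∈ y∈ x≢y = ≤inv⇒Disjoint (pairwise x∈ y∈ x≢y)

  star-AllPairs : ∀ {σ} → IsStar σ → AllPairs Disjoint σ
  star-AllPairs st@(_ , uniq , _) = AllPairs-distinct uniq (star-disjoint st)

  image-star : (g : Sep n → Sep n) → (∀ {u v} → Disjoint u v → Disjoint (g u) (g v)) →
               ∀ σ → IsStar σ → IsStar (image g σ)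
  image-star g g# []      (nonempty , _) = contradiction refl nonempty
  image-star g g# (s ∷ σ) st             = (λ ()) , deduplicate-! _≟ˢ_ (map g (s ∷ σ)) , pairwise
    where
    pairwise : ∀ {x y} → x ∈ˡ image g (s ∷ σ) → y ∈ˡ image g (s ∷ σ) → x ≢ y → x ≤ˢ inv y
    pairwise x∈ y∈ x≢y with ∈-map⁻ g (AnyP.deduplicate⁻ _≟ˢ_ x∈) | ∈-map⁻ g (AnyP.deduplicate⁻ _≟ˢ_ y∈)
    ... | u , u∈ , refl | v , v∈ , refl = Disjoint⇒≤inv (g# (star-disjoint st u∈ v∈ (x≢y ∘ cong g)))

module MatroidFacts {n : ℕ} (M : Matroid n) where
  open Matroid M

  -- L(X) = λ(X) + r(M).
  L : Subset n → ℕ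
  L X = r X + r (∁ X)

  L-∁ : ∀ X → L (∁ X) ≡ L X
  L-∁ X = trans (cong (λ Y → r (∁ X) + r Y) (∁-involutive X)) (+-comm (r (∁ X)) (r X))

  L-submod : ∀ X Y → L (X ∪ Y) + L (X ∩ Y) ≤ L X + L Y
  L-submod X Y = begin
      (r (X ∪ Y) + r (∁ (X ∪ Y))) + (r (X ∩ Y) + r (∁ (X ∩ Y)))
        ≡⟨ cong₂ (λ P Q → (r (X ∪ Y) + r P) + (r (X ∩ Y) + r Q)) (∁-∪ X Y) (∁-∩ X Y) ⟩
      (r (X ∪ Y) + r (∁ X ∩ ∁ Y)) + (r (X ∩ Y) + r (∁ X ∪ ∁ Y))
        ≡⟨ trans (interchange (r (X ∪ Y)) (r (∁ X ∩ ∁ Y)) (r (X ∩ Y)) (r (∁ X ∪ ∁ Y)))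
                 (cong (_+_ (r (X ∪ Y) + r (X ∩ Y))) (+-comm (r (∁ X ∩ ∁ Y)) (r (∁ X ∪ ∁ Y)))) ⟩
      (r (X ∪ Y) + r (X ∩ Y)) + (r (∁ X ∪ ∁ Y) + r (∁ X ∩ ∁ Y))
        ≤⟨ +-mono-≤ (r-submod X Y) (r-submod (∁ X) (∁ Y)) ⟩
      (r X + r Y) + (r (∁ X) + r (∁ Y))
        ≡⟨ interchange (r X) (r Y) (r (∁ X)) (r (∁ Y)) ⟩
      L X + L Y ∎
    where open ℕP.≤-Reasoning

  Minimal : Subset n → Subset n → Set
  Minimal X S = ∀ C → X ⊆ C → C ⊆ S → L S ≤ L C

  uncross : ∀ A S C → A ∩ S ⊆ C → L S ≤ L C → r (∁ (A ∪ S)) + r S ≤ r (∁ A) + r C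
  uncross A S C A∩S⊆C LS≤LC = +-≤-cancel {r (∁ (A ∪ S))} {r (∁ A)} {r S} {r C} co-submod through-C
    where
    co-submod : r (∁ (A ∪ S)) + r (∁ A ∪ ∁ S) ≤ r (∁ A) + r (∁ S)
    co-submod = subst (λ P → r P + r (∁ A ∪ ∁ S) ≤ r (∁ A) + r (∁ S)) (sym (∁-∪ A S))
                  (≤-trans (≤-reflexive (+-comm (r (∁ A ∩ ∁ S)) (r (∁ A ∪ ∁ S)))) (r-submod (∁ A) (∁ S)))
    through-C : r S + r (∁ S) ≤ r C + r (∁ A ∪ ∁ S)
    through-C = ≤-trans LS≤LC (+-monoʳ-≤ (r C)
                  (r-mono _ _ (subst (∁ C ⊆_) (∁-∩ A S) (p⊆q⇒∁p⊇∁q A∩S⊆C))))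

  ρ : Subset n → ℕ
  ρ s = r (∁ s)

  Σρ : List (Subset n) → ℕ
  Σρ l = sum (map ρ l)

  telescope : ∀ C l → AllPairs Disjoint l → Σρ (map (_∖ C) l) + r (C ∖⋃ l) ≤ Σρ l + r C
  telescope C []      []            = ≤-refl
  telescope C (s ∷ l) (s#l ∷ l#) =
    +-≤-chain {ρ (s ∖ C)} {ρ s} {Σρ (map (_∖ C) l)} {Σρ l} step (telescope C l l#)
    where
    D : Subset n
    D = C ∖⋃ l
    -- an element of C ∩ s misses every later member of l
    cover : ∁ (s ∖ C) ⊆ ∁ s ∪ D
    cover {j} j∈ with x∈p∪q⁻ (∁ s) C (subst (j ∈_) (∁-involutive _) j∈) | j ∈? s
    ... | inj₁ j∈∁s | _       = x∈p∪q⁺ (inj₁ j∈∁s)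
    ... | inj₂ j∈C  | yes j∈s = x∈p∪q⁺ (inj₂ (∈∖⋃⁺ l j∈C (All.map (λ s#t → s#t j∈s) s#l)))
    ... | inj₂ _    | no j∉s  = x∈p∪q⁺ (inj₁ (x∉p⇒x∈∁p j∉s))
    step : ρ (s ∖ C) + r (∁ s ∩ D) ≤ ρ s + r D
    step = ≤-trans (+-monoˡ-≤ _ (r-mono _ _ cover)) (r-submod (∁ s) D)

  rank-nonempty : ∀ X → 0 < r X → Nonempty X
  rank-nonempty X 0<rX with nonempty? X
  ... | yes nonempty = nonempty
  ... | no empty     = contradiction rX≤0 (<⇒≱ 0<rX)
    where
    rX≤0 : r X ≤ 0
    rX≤0 = ≤-trans (r-bound X) (≤-reflexive (trans (cong ∣_∣ (Empty-unique empty)) (∣⊥∣≡0 n)))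

  δ : Subset n → ℕ
  δ s = rM M ∸ ρ s

  Σδ : List (Subset n) → ℕ
  Σδ l = sum (map δ l)

  Σδ+Σρ : ∀ l → Σδ l + Σρ l ≡ length l * rM M
  Σδ+Σρ = sum-complement ρ (rM M) (λ s → r-mono _ _ ⊆⊤)

  Σδ-anti : ∀ l l' → length l' ≡ length l → Σρ l' ≤ Σρ l → Σδ l ≤ Σδ l'
  Σδ-anti l l' same-length ρ-lower = +-cancelʳ-≤ (Σρ l) _ _ (begin
      Σδ l + Σρ l       ≡⟨ Σδ+Σρ l ⟩
      length l * rM M   ≡⟨ cong (_* rM M) (sym same-length) ⟩
      length l' * rM M  ≡⟨ sym (Σδ+Σρ l') ⟩
      Σδ l' + Σρ l'     ≤⟨ +-monoʳ-≤ (Σδ l') ρ-lower ⟩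
      Σδ l' + Σρ l      ∎)
    where open ℕP.≤-Reasoning

  self-disjoint⇒δ≡0 : ∀ {x} → Disjoint x x → δ x ≡ 0
  self-disjoint⇒δ≡0 {x} x#x = trans (cong (λ Y → rM M ∸ r Y) ∁x≡⊤) (n∸n≡0 (rM M))
    where
    ∁x≡⊤ : ∁ x ≡ ⊤
    ∁x≡⊤ = ⊆-antisym ⊆⊤ (λ _ → x∉p⇒x∈∁p (λ j∈x → x#x j∈x j∈x))

  Σδ-deduplicate : ∀ l → AllPairs Disjoint l → Σδ (deduplicate _≟ˢ_ l) ≡ Σδ l
  Σδ-deduplicate l l# =
    sum-deduplicate δ _≟ˢ_ l (AllPairs.map (λ { x#y refl → self-disjoint⇒δ≡0 x#y }) l#)

module Orders {n : ℕ} (M : Matroid n) (k : ℕ) where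
  open Matroid M
  open MatroidFacts M

  InS-anti : ∀ {s t} → L s ≤ L t → InS M k t → InS M k s
  InS-anti Ls≤Lt = ℤP.≤-<-trans (ℤP.+-monoˡ-≤ (ℤ.- + rM M) (ℤ.+≤+ Ls≤Lt))

  sumRB≡Σρ : ∀ l → sumRB M k l ≡ + Σρ l
  sumRB≡Σρ []      = refl
  sumRB≡Σρ (s ∷ l) = cong (ℤ._+_ (+ ρ s)) (sumRB≡Σρ l)

  norm-deficit : ∀ σ → σ ≢ [] → norm M k σ ≡ + rM M - + Σδ σ
  norm-deficit []      nonempty = contradiction refl nonempty
  norm-deficit (s ∷ l) _        = begin
      norm M k (s ∷ l)
        ≡⟨ cong₂ _-_ (sumRB≡Σρ (s ∷ l)) (sym (ℤP.pos-* (length l) (rM M))) ⟩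
      + Σρ (s ∷ l) - + (length l * rM M)
        ≡⟨ sum-swap {+ Σδ (s ∷ l)} {+ Σρ (s ∷ l)} {+ rM M} {+ (length l * rM M)}
                    (cong +_ (Σδ+Σρ (s ∷ l))) ⟩
      + rM M - + Σδ (s ∷ l) ∎
    where open ≡-Reasoning

  -- If t is not forced, the star {inv t} of order r(t) is not in 𝓕_k.
  unforced⇒rank : ∀ t → ¬ forces M k (Fk M k) t → k ≤ r t
  unforced⇒rank t unforced = ≮⇒≥ (λ rt<k → unforced (inj₁ (singleton-star , order<k rt<k)))
    where
    singleton-star : IsStar [ inv t ]
    singleton-star = (λ ()) , ([] ∷ []) , λ { (here refl) (here refl) x≢x → contradiction refl x≢x }
    -- ‖{inv t}‖ computes to r(E∖(E∖t)) + 0 + 0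
    order<k : r t < k → norm M k [ inv t ] ℤ.< + k
    order<k rt<k = ℤ.+<+ (subst (_< k) (sym (trans (ℕP.+-identityʳ _) (trans (ℕP.+-identityʳ _)
                     (cong r (∁-involutive t))))) rt<k)

module Shifting {n : ℕ} (M : Matroid n) (k : ℕ) (X S₀ : Subset n) where
  open MatroidFacts M
  open Orders M k

  f : Sep n → Sep n
  f = shift M k (Fk M k) X S₀

  shift-up : ∀ {s} → X ⊆ s → f s ≡ s ∪ S₀
  shift-up {s} X⊆s with X ≤ˢ? s
  ... | yes _   = refl
  ... | no X≰s = contradiction (⊆⇒≤ˢ X⊆s) X≰s

  shift-down : ∀ {i s} → i ∈ X → i ∉ s → f s ≡ s ∖ S₀
  shift-down {s = s} i∈X i∉s with X ≤ˢ? s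
  ... | yes (X⊆s , _) = contradiction (X⊆s i∈X) i∉s
  ... | no _          = refl

  shift-cases : ∀ s → (X ⊆ s × f s ≡ s ∪ S₀) ⊎ f s ≡ s ∖ S₀
  shift-cases s with X ≤ˢ? s
  ... | yes (X⊆s , _) = inj₁ (X⊆s , refl)
  ... | no _          = inj₂ refl

  -- For nonempty X the shift preserves disjointness: two disjoint sets
  -- cannot both contain X.
  shift-disjoint : ∀ {i} → i ∈ X → ∀ {u v} → Disjoint u v → Disjoint (f u) (f v)
  shift-disjoint i∈X {u} {v} u#v with shift-cases u | shift-cases v
  ... | inj₁ (X⊆u , _) | inj₁ (X⊆v , _) = contradiction (X⊆v i∈X) (u#v (X⊆u i∈X))
  ... | inj₁ (_ , fu)  | inj₂ fv        = subst₂ Disjoint (sym fu) (sym fv) (∪-∖-disjoint u#v)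
  ... | inj₂ fu        | inj₁ (_ , fv)  =
    subst₂ Disjoint (sym fu) (sym fv) (Disjoint-sym (∪-∖-disjoint (Disjoint-sym u#v)))
  ... | inj₂ fu        | inj₂ fv        = subst₂ Disjoint (sym fu) (sym fv) (∖-disjoint u#v)

  module Linking {i : Fin n} (i∈X : i ∈ X) (X⊆S₀ : X ⊆ S₀) (minimal : Minimal X S₀) where

    L-∪S₀ : ∀ {s} → X ⊆ s → L (s ∪ S₀) ≤ L s
    L-∪S₀ {s} X⊆s = +-cancelʳ-≤ (L (s ∩ S₀)) _ _
      (≤-trans (L-submod s S₀) (+-monoʳ-≤ (L s) (minimal (s ∩ S₀) X⊆s∩S₀ (p∩q⊆q s S₀))))
      where
      X⊆s∩S₀ : X ⊆ s ∩ S₀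
      X⊆s∩S₀ j∈X = x∈p∩q⁺ (X⊆s j∈X , X⊆S₀ j∈X)

    shift-Σρ : ∀ σ → IsStar σ → ∀ {a} → a ∈ˡ σ → X ⊆ a → Σρ (map f σ) ≤ Σρ σ
    -- Write σ ↭ a ∷ rest; every member of rest is disjoint from a, so it
    -- misses X and is shifted down.  Uncrossing a with S₀ against
    -- Cl = S₀ ∖ ⋃ rest (which lies between X and S₀) and telescoping over
    -- rest then cancel the terms r(S₀) and r(Cl).
    shift-Σρ σ st {a} a∈σ X⊆a
      with rest , σ↭ ← extract a∈σ
      with a#rest ∷ rest# ← AllPairs-↭ Disjoint-sym σ↭ (star-AllPairs st) = begin
        Σρ (map f σ)                         ≡⟨ sum-↭ (map⁺ ρ (map⁺ f σ↭)) ⟩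
        ρ (f a) + Σρ (map f rest)            ≡⟨ cong₂ _+_ (cong ρ (shift-up X⊆a))
                                                    (cong Σρ (map-cong-local (All.map rest-down a#rest))) ⟩
        ρ (a ∪ S₀) + Σρ (map (_∖ S₀) rest)  ≤⟨ +-≤-cancel {ρ (a ∪ S₀)} {ρ a} {Σρ (map (_∖ S₀) rest)} {Σρ rest}
                                                   (uncross a S₀ Cl a∩S₀⊆Cl (minimal Cl X⊆Cl Cl⊆S₀))
                                                   (telescope S₀ rest rest#) ⟩
        ρ a + Σρ rest                        ≡⟨ sym (sum-↭ (map⁺ ρ σ↭)) ⟩
        Σρ σ                                 ∎
      where
      open ℕP.≤-Reasoning
      Cl : Subset n
      Cl = S₀ ∖⋃ rest
      Cl⊆S₀ : Cl ⊆ S₀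
      Cl⊆S₀ = ∖⋃-⊆ S₀ rest
      off-rest : ∀ {j} → j ∈ a → All (j ∉_) rest
      off-rest j∈a = All.map (λ a#s → a#s j∈a) a#rest
      X⊆Cl : X ⊆ Cl
      X⊆Cl j∈X = ∈∖⋃⁺ rest (X⊆S₀ j∈X) (off-rest (X⊆a j∈X))
      a∩S₀⊆Cl : a ∩ S₀ ⊆ Cl
      a∩S₀⊆Cl j∈ with j∈a , j∈S₀ ← x∈p∩q⁻ a S₀ j∈ = ∈∖⋃⁺ rest j∈S₀ (off-rest j∈a)
      rest-down : ∀ {s} → Disjoint a s → f s ≡ s ∖ S₀
      rest-down a#s = shift-down i∈X (a#s (X⊆a i∈X))

    shift-Fk : ∀ σ → Fk M k σ → ∀ {a} → a ∈ˡ σ → X ⊆ a → Fk M k (image f σ)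
    shift-Fk σ (st , order<k) a∈σ X⊆a = image-st , (begin-strict
        norm M k (image f σ)            ≡⟨ norm-deficit (image f σ) (proj₁ image-st) ⟩
        + rM M - + Σδ (image f σ)       ≡⟨ cong (λ d → + rM M - + d) (Σδ-deduplicate (map f σ) image#) ⟩
        + rM M - + Σδ (map f σ)         ≤⟨ ℤP.+-monoʳ-≤ (+ rM M) (ℤP.neg-mono-≤ (ℤ.+≤+ deficit-grows)) ⟩
        + rM M - + Σδ σ                 ≡⟨ sym (norm-deficit σ (proj₁ st)) ⟩
        norm M k σ                      <⟨ order<k ⟩
        + k                             ∎)
      where
      open ℤP.≤-Reasoning
      image-st : IsStar (image f σ)
      image-st = image-star f (shift-disjoint i∈X) σ st
      image# : AllPairs Disjoint (map f σ)
      image# = AllPairsP.map⁺ (AllPairs.map (shift-disjoint i∈X) (star-AllPairs st))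
      deficit-grows : Σδ σ ≤ Σδ (map f σ)
      deficit-grows = Σδ-anti σ (map f σ) (length-map f σ) (shift-Σρ σ st a∈σ X⊆a)

    Flinked-minimal : Flinked M k (Fk M k) X S₀
    Flinked-minimal = (⊆⇒≤ˢ X⊆S₀ , union-in-S) , stars
      where
      union-in-S : ∀ s → InS M k s → X ≤ˢ s → s ≢ inv X → InS M k (s ∨ˢ S₀)
      union-in-S s s∈S (X⊆s , _) _ = InS-anti (L-∪S₀ X⊆s) s∈S
      stars : ∀ σ → IsStar σ → Fk M k σ → All (λ s → InS≥ M k (Fk M k) X s × s ≢ inv X) σ →
              Any (X ≤ˢ_) σ → Fk M k (image f σ)
      stars σ _ σ∈F _ above with a , a∈σ , (X⊆a , _) ← find above = shift-Fk σ σ∈F a∈σ X⊆a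

module Interval {n : ℕ} (M : Matroid n) (t t' : Subset n) where
  open MatroidFacts M

  Between : Subset n → Set
  Between S = t ⊆ S × S ⊆ t'

  between? : Decidable Between
  between? S = (t ⊆? S) ×-dec (S ⊆? t')

  interval-minimal : ∀ {S₀} → Between S₀ → (∀ S → Between S → L S₀ ≤ L S) →
                     Minimal t S₀ × Minimal (∁ t') (∁ S₀)
  interval-minimal {S₀} (t⊆S₀ , S₀⊆t') least =
      (λ C t⊆C C⊆S₀ → least C (t⊆C , ⊆-trans C⊆S₀ S₀⊆t'))
    , λ C ∁t'⊆C C⊆∁S₀ → begin
        L (∁ S₀) ≡⟨ L-∁ S₀ ⟩
        L S₀     ≤⟨ least (∁ C) (⊆-trans t⊆S₀ (⊆∁-flip C⊆∁S₀) , ∁⊆-flip ∁t'⊆C) ⟩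
        L (∁ C)  ≡⟨ L-∁ C ⟩
        L C      ∎
    where open ℕP.≤-Reasoning

lemma5p15 : (n : ℕ) (M : Matroid n) (k : ℕ) → 0 < k → separable M k (Fk M k)
lemma5p15 n M k 0<k t t' t∈S _ (t⊆t' , _) t-unforced t'-unforced
  with S₀ , in-interval@(t⊆S₀ , S₀⊆t') , least
         ← minimiser (MatroidFacts.L M) (Interval.between? M t t') (⊆-refl , t⊆t')
  with minimal-t , minimal-∁t' ← Interval.interval-minimal M t t' in-interval least =
    S₀ , InS-anti (least t (⊆-refl , t⊆t')) t∈S
       , Shifting.Linking.Flinked-minimal M k t S₀ (proj₂ (nonempty t t-unforced)) t⊆S₀ minimal-t
       , Shifting.Linking.Flinked-minimal M k (∁ t') (∁ S₀) (proj₂ (nonempty (∁ t') t'-unforced))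
                                          (p⊆q⇒∁p⊇∁q S₀⊆t') minimal-∁t'
  where
  open MatroidFacts M
  open Orders M k
  nonempty : ∀ u → ¬ forces M k (Fk M k) u → Nonempty u
  nonempty u unforced = rank-nonempty u (<-≤-trans 0<k (unforced⇒rank u unforced))
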